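{- Let $X$ be a set with a binary operation $\ast$ and an element $0\in X$ such that for all $x,y,z\in X$: (G) $((x\ast y)\ast z)\ast((x\ast(z\ast 0))\ast y)=0$, and (A3) if $x\ast y=0$ and $y\ast x=0$ then $x=y$. Then $(x\ast 0)\ast 0 = x$ for all $x\in X$. -}

-- The crux is 0 ∗ 0 = 0.  It comes from the general fact that 0 ∗ (x ∗ 0) = 0 forces
-- 0 ∗ x = 0, applied to a suitable ground term.  Given 0 ∗ 0 = 0, the same fact shows that
-- t ∗ 0 = 0 forces t = 0, so instances of (G) whose right factor vanishes lose their
-- trailing ∗ 0.  This yields x ∗ ((x ∗ 0) ∗ 0) = 0 and ((x ∗ 0) ∗ 0) ∗ x = 0, and A3 concludes.
module Submission where

open import Level using (Level)
open import Relation.Binary.PropositionalEquality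
  using (_≡_; sym; trans; cong; subst; subst₂; module ≡-Reasoning)

module _ {a : Level} {X : Set a} (_∗_ : X → X → X) (0# : X)
  (G : ∀ x y z → (((x ∗ y) ∗ z) ∗ ((x ∗ (z ∗ 0#)) ∗ y)) ≡ 0#)
  (A3 : ∀ x y → (x ∗ y) ≡ 0# → (y ∗ x) ≡ 0# → x ≡ y) where

  G-left-0 : ∀ {u v w} → (u ∗ v) ∗ w ≡ 0# → 0# ∗ ((u ∗ (w ∗ 0#)) ∗ v) ≡ 0#
  G-left-0 {u} {v} {w} p = subst (λ h → h ∗ ((u ∗ (w ∗ 0#)) ∗ v) ≡ 0#) p (G u v w)

  G-right-0 : ∀ {u v w} → (u ∗ (w ∗ 0#)) ∗ v ≡ 0# → ((u ∗ v) ∗ w) ∗ 0# ≡ 0#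
  G-right-0 {u} {v} {w} p = subst (λ h → ((u ∗ v) ∗ w) ∗ h ≡ 0#) p (G u v w)

  G-inner-0 : ∀ {u w} v → u ∗ (w ∗ 0#) ≡ 0# → ((u ∗ v) ∗ w) ∗ (0# ∗ v) ≡ 0#
  G-inner-0 {u} {w} v p = subst (λ h → ((u ∗ v) ∗ w) ∗ (h ∗ v) ≡ 0#) p (G u v w)

  0∗[x∗0]≡0⇒[0∗x]∗0≡0 : ∀ {x} → 0# ∗ (x ∗ 0#) ≡ 0# → (0# ∗ x) ∗ 0# ≡ 0#
  0∗[x∗0]≡0⇒[0∗x]∗0≡0 {x} p = subst (λ h → (h ∗ x) ∗ h ≡ 0#) p (G-inner-0 (x ∗ 0#) p)

  0∗[x∗0]≡0⇒0∗[0∗x]≡0 : ∀ {x} → 0# ∗ (x ∗ 0#) ≡ 0# → 0# ∗ (0# ∗ x) ≡ 0#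
  0∗[x∗0]≡0⇒0∗[0∗x]≡0 {x} p = begin
    0# ∗ (0# ∗ x)                 ≡⟨ cong (λ h → 0# ∗ (h ∗ x)) (sym (inner-vanishes (x ∗ 0#))) ⟩
    0# ∗ ((0# ∗ k) ∗ x)           ≡⟨ cong (λ h → 0# ∗ ((h ∗ k) ∗ x)) (sym (G 0# 0# x)) ⟩
    0# ∗ (((u ∗ v) ∗ k) ∗ x)      ≡⟨ G-left-0 (G u v x) ⟩
    0#                            ∎
    where
    open ≡-Reasoning
    u v k : X
    u = (0# ∗ 0#) ∗ x
    v = (0# ∗ (x ∗ 0#)) ∗ 0#
    k = ((u ∗ (x ∗ 0#)) ∗ v) ∗ 0#

    inner-vanishes : ∀ y → 0# ∗ (((u ∗ y) ∗ ((0# ∗ y) ∗ 0#)) ∗ 0#) ≡ 0#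
    inner-vanishes y =
      G-left-0 (subst (λ h → ((u ∗ y) ∗ h) ∗ (0# ∗ y) ≡ 0#) p (G-inner-0 y (G 0# 0# x)))

  0∗[x∗0]≡0⇒0∗x≡0 : ∀ {x} → 0# ∗ (x ∗ 0#) ≡ 0# → 0# ∗ x ≡ 0#
  0∗[x∗0]≡0⇒0∗x≡0 {x} p = A3 (0# ∗ x) 0# (0∗[x∗0]≡0⇒[0∗x]∗0≡0 p) (0∗[x∗0]≡0⇒0∗[0∗x]≡0 p)

  0∗0≡0 : 0# ∗ 0# ≡ 0#
  0∗0≡0 = subst (λ h → 0# ∗ h ≡ 0#) 0∗c≡0 (0∗[x∗0]≡0⇒0∗[0∗x]≡0 0∗[c∗0]≡0)
    where
    e c : X
    e = 0# ∗ 0#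
    c = 0# ∗ ((0# ∗ e) ∗ 0#)

    -- Read e ∗ (0 ∗ e) as (h ∗ k) ∗ (0 ∗ e) with h and k vanishing instances of (G).
    e∗[0∗e]≡0 : e ∗ (0# ∗ e) ≡ 0#
    e∗[0∗e]≡0 = subst₂ (λ h k → (h ∗ k) ∗ (0# ∗ e) ≡ 0#)
      (G-inner-0 0# (G 0# 0# 0#)) (G 0# 0# 0#)
      (G-inner-0 e (G (e ∗ 0#) 0# (0# ∗ e)))

    0∗[c∗0]≡0 : 0# ∗ (c ∗ 0#) ≡ 0#
    0∗[c∗0]≡0 = G-left-0 e∗[0∗e]≡0

    0∗c≡0 : 0# ∗ c ≡ 0#
    0∗c≡0 = 0∗[x∗0]≡0⇒0∗x≡0 0∗[c∗0]≡0

  ∗0≡0⇒≡0 : ∀ {x} → x ∗ 0# ≡ 0# → x ≡ 0#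
  ∗0≡0⇒≡0 {x} p =
    A3 x 0# p (0∗[x∗0]≡0⇒0∗x≡0 (trans (cong (0# ∗_) p) 0∗0≡0))

  [[x∗y]∗[[x∗[[z∗0]∗0]]∗y]]∗z≡0 : ∀ x y z → ((x ∗ y) ∗ ((x ∗ ((z ∗ 0#) ∗ 0#)) ∗ y)) ∗ z ≡ 0#
  [[x∗y]∗[[x∗[[z∗0]∗0]]∗y]]∗z≡0 x y z = ∗0≡0⇒≡0 (G-right-0 (G x y (z ∗ 0#)))

  [0∗0]∗0≡0 : (0# ∗ 0#) ∗ 0# ≡ 0#
  [0∗0]∗0≡0 = trans (cong (_∗ 0#) 0∗0≡0) 0∗0≡0

  [x∗y]∗[[x∗0]∗y]≡0 : ∀ x y → (x ∗ y) ∗ ((x ∗ 0#) ∗ y) ≡ 0#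
  [x∗y]∗[[x∗0]∗y]≡0 x y = ∗0≡0⇒≡0
    (subst (λ h → ((x ∗ y) ∗ ((x ∗ h) ∗ y)) ∗ 0# ≡ 0#) [0∗0]∗0≡0
      ([[x∗y]∗[[x∗[[z∗0]∗0]]∗y]]∗z≡0 x y 0#))

  x∗[[x∗0]∗0]≡0 : ∀ x → x ∗ ((x ∗ 0#) ∗ 0#) ≡ 0#
  x∗[[x∗0]∗0]≡0 x = ∗0≡0⇒≡0
    (subst (λ h → (x ∗ ((x ∗ 0#) ∗ 0#)) ∗ h ≡ 0#) ([x∗y]∗[[x∗0]∗y]≡0 x 0#)
      ([x∗y]∗[[x∗0]∗y]≡0 x ((x ∗ 0#) ∗ 0#)))

  [[x∗0]∗0]∗x≡0 : ∀ x → ((x ∗ 0#) ∗ 0#) ∗ x ≡ 0#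
  [[x∗0]∗0]∗x≡0 x =
    subst (λ h → ((x ∗ 0#) ∗ h) ∗ x ≡ 0#) 0∗0≡0
      (subst (λ h → ((x ∗ 0#) ∗ (h ∗ 0#)) ∗ x ≡ 0#) (x∗[[x∗0]∗0]≡0 x)
        ([[x∗y]∗[[x∗[[z∗0]∗0]]∗y]]∗z≡0 x 0# x))

  [x∗0]∗0≡x : ∀ x → (x ∗ 0#) ∗ 0# ≡ x
  [x∗0]∗0≡x x = A3 ((x ∗ 0#) ∗ 0#) x ([[x∗0]∗0]∗x≡0 x) (x∗[[x∗0]∗0]≡0 x)

lemma6 : ∀ {a : Level} (X : Set a) (_∗_ : X → X → X) (0# : X) →
         (∀ x y z → (((x ∗ y) ∗ z) ∗ ((x ∗ (z ∗ 0#)) ∗ y)) ≡ 0#) →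
         (∀ x y → (x ∗ y) ≡ 0# → (y ∗ x) ≡ 0# → x ≡ y) →
         ∀ x → ((x ∗ 0#) ∗ 0#) ≡ x
lemma6 X _∗_ 0# G A3 = [x∗0]∗0≡x _∗_ 0# G A3
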